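{- Let $Q,P_0,P_1$ be finite posets and $i_k:Q\to P_k$ ($k=0,1$) injective maps with $q<_Qq'\iff i_k(q)<_ki_k(q')$. Let $P=P_0\,{}_{Q_0}\#_{Q_1}P_1$ be the connected sum, and let $\mu_k$ be the Möbius function of $P_k$. Then for $x,y\in P_0\sqcup P_1$, \[ \mu_P(x,y)=\begin{cases}\mu_k(x,y) & \text{if } x,y\in P_k,\ k\in\{0,1\},\\ -\displaystyle\sum_{\substack{p_0\in P_0,\ p_1\in P_1\\ x\le_0p_0,\ p_0\preceq p_1,\ p_1\le_1y}}\mu_0(x,p_0)\mu_1(p_1,y) & \text{if } x\in P_0,\ y\in P_1,\\ 0 & \text{otherwise.}\end{cases} \]
   Context: For a finite poset $R$, its Möbius function $\mu_R$ is defined by $\mu_R(x,x)=1$, $\mu_R(x,y)=0$ unless $x\le y$, and $\sum_{x\le z\le y}\mu_R(x,z)=0$ for $x<y$. Given $Q,P_0,P_1,i_0,i_1$ as in the claim, with $Q_k=i_k(Q)$, the connected sum $P=P_0\,{}_{Q_0}\#_{Q_1}P_1$ is the disjoint union $P_0\sqcup P_1$ with the partial order $\preceq$: $x\preceq y$ iff either $x,y$ lie in the same $P_k$ and $x\le_ky$, or $x\in P_0$, $y\in P_1$ and there exists $q\in Q$ with $x\le_0i_0(q)$ and $i_1(q)\le_1y$. -}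

module Defs where

open import Level using (0ℓ)
open import Data.Nat using (ℕ)
open import Data.Integer using (ℤ; 0ℤ; 1ℤ; _+_; _*_; -_)
open import Data.Fin using (Fin)
open import Data.Fin.Properties using (any?)
open import Data.List using (List; map; foldr)
open import Data.Fin.Base using ()
open import Data.List.Base using (allFin)
open import Data.Bool using (if_then_else_)
open import Data.Sum using (_⊎_; inj₁; inj₂)
open import Data.Product using (_×_; Σ; ∃; _,_)
open import Data.Empty using (⊥)
open import Function using (_∘_)
open import Function.Definitions using (Injective)
open import Relation.Nullary using (¬_; Dec; does; yes; no)
open import Relation.Nullary.Decidable using (_×-dec_)
open import Relation.Binary using (Rel; Decidable; IsPartialOrder)
open import Relation.Binary.PropositionalEquality using (_≡_; _≢_)

record FinPoset : Set₁ where
  field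
    n              : ℕ
    _≤_            : Rel (Fin n) 0ℓ
    _≤?_           : Decidable _≤_
    isPartialOrder : IsPartialOrder _≡_ _≤_

  _<_ : Rel (Fin n) 0ℓ
  x < y = (x ≤ y) × (x ≢ y)

open FinPoset public

∑ : (n : ℕ) → (Fin n → ℤ) → ℤ
∑ n f = foldr _+_ 0ℤ (map f (allFin n))

∑⊎ : (n₀ n₁ : ℕ) → (Fin n₀ ⊎ Fin n₁ → ℤ) → ℤ
∑⊎ n₀ n₁ f = ∑ n₀ (f ∘ inj₁) + ∑ n₁ (f ∘ inj₂)

IsMobius : {A : Set} → ((A → ℤ) → ℤ) → (_≤_ : Rel A 0ℓ) → Decidable _≤_ →
           (A → A → ℤ) → Set
IsMobius {A} sumA _≤_ _≤?_ μ =
  (∀ x → μ x x ≡ 1ℤ)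
  × (∀ x y → ¬ (x ≤ y) → μ x y ≡ 0ℤ)
  × (∀ x y → x ≤ y → x ≢ y →
       sumA (λ z → if does ((x ≤? z) ×-dec (z ≤? y)) then μ x z else 0ℤ) ≡ 0ℤ)

IsMobiusOf : (R : FinPoset) → (Fin (n R) → Fin (n R) → ℤ) → Set
IsMobiusOf R μ = IsMobius (∑ (n R)) (_≤_ R) (_≤?_ R) μ

IsOrderEmbedding : (Q P : FinPoset) → (Fin (n Q) → Fin (n P)) → Set
IsOrderEmbedding Q P i =
  Injective _≡_ _≡_ i
  × (∀ q q' → _<_ Q q q' → _<_ P (i q) (i q'))
  × (∀ q q' → _<_ P (i q) (i q') → _<_ Q q q')

module ConnectedSum (Q P₀ P₁ : FinPoset)
                    (i₀ : Fin (n Q) → Fin (n P₀))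
                    (i₁ : Fin (n Q) → Fin (n P₁)) where

  Cross : Fin (n P₀) → Fin (n P₁) → Set
  Cross x y = ∃ λ q → _≤_ P₀ x (i₀ q) × _≤_ P₁ (i₁ q) y

  cross? : ∀ x y → Dec (Cross x y)
  cross? x y = any? (λ q → _≤?_ P₀ x (i₀ q) ×-dec _≤?_ P₁ (i₁ q) y)

  data _⪯_ : Fin (n P₀) ⊎ Fin (n P₁) → Fin (n P₀) ⊎ Fin (n P₁) → Set where
    in₀   : ∀ {x y} → _≤_ P₀ x y → inj₁ x ⪯ inj₁ y
    in₁   : ∀ {x y} → _≤_ P₁ x y → inj₂ x ⪯ inj₂ y
    cross : ∀ {x y} → Cross x y → inj₁ x ⪯ inj₂ y

  _⪯?_ : Decidable _⪯_
  inj₁ x ⪯? inj₁ y with _≤?_ P₀ x y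
  ... | yes p = yes (in₀ p)
  ... | no ¬p = no λ { (in₀ p) → ¬p p }
  inj₂ x ⪯? inj₂ y with _≤?_ P₁ x y
  ... | yes p = yes (in₁ p)
  ... | no ¬p = no λ { (in₁ p) → ¬p p }
  inj₁ x ⪯? inj₂ y with cross? x y
  ... | yes p = yes (cross p)
  ... | no ¬p = no λ { (cross p) → ¬p p }
  inj₂ x ⪯? inj₁ y = no λ ()

  IsMobiusP : (Fin (n P₀) ⊎ Fin (n P₁) → Fin (n P₀) ⊎ Fin (n P₁) → ℤ) → Set
  IsMobiusP = IsMobius (∑⊎ (n P₀) (n P₁)) _⪯_ _⪯?_

  formula : (Fin (n P₀) → Fin (n P₀) → ℤ) → (Fin (n P₁) → Fin (n P₁) → ℤ) →
            Fin (n P₀) ⊎ Fin (n P₁) → Fin (n P₀) ⊎ Fin (n P₁) → ℤ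
  formula μ₀ μ₁ (inj₁ x) (inj₁ y) = μ₀ x y
  formula μ₀ μ₁ (inj₂ x) (inj₂ y) = μ₁ x y
  formula μ₀ μ₁ (inj₁ x) (inj₂ y) =
    - ∑ (n P₀) (λ p₀ → ∑ (n P₁) (λ p₁ →
        if does (_≤?_ P₀ x p₀ ×-dec (inj₁ p₀ ⪯? inj₂ p₁) ×-dec _≤?_ P₁ p₁ y)
        then μ₀ x p₀ * μ₁ p₁ y else 0ℤ))
  formula μ₀ μ₁ (inj₂ x) (inj₁ y) = 0ℤ

module Submission where

-- A Möbius function is determined by its three defining axioms, so it
-- suffices to show that the right-hand side  F = formula μ₀ μ₁  satisfies
-- them on P = P₀ #_Q P₁; uniqueness then forces μ = F.
--
-- For x ∈ P₀, y ∈ P₁, expanding F(x,z) for z ∈ P₁ and exchanging sums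
--     turns the P₁-part of Σ_{x ⪯ z ⪯ y} F(x,z) into
--     −Σ_{p₀} [x ≤ p₀ ⪯ y] μ₀(x,p₀), which cancels the P₀-part.

open import Defs
open import Level using (0ℓ)
open import Data.Nat using (ℕ; zero; suc)
open import Data.Integer using (ℤ; 0ℤ; 1ℤ; -1ℤ; _+_; _*_; -_; _-_)
open import Data.Integer.Properties
  using ( +-*-semiring; +-commutativeSemigroup; +-identityˡ; +-identityʳ
        ; +-inverseʳ; *-zeroʳ; *-identityʳ; -1*i≡-i; i-j≡0⇒i≡j )
open import Data.Integer.Tactic.RingSolver using (solve-∀)
import Algebra.Properties.Semiring.Sum +-*-semiring as Sum
open import Algebra.Properties.CommutativeSemigroup +-commutativeSemigroup
  using (interchange)
open import Data.Fin using (Fin; zero; suc; punchIn)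
open import Data.Fin.Properties using (punchInᵢ≢i) renaming (_≟_ to _≟ᶠ_)
open import Data.Fin.Induction using (po-wellFounded)
open import Data.List using (foldr; tabulate)
open import Data.List.Properties using (map-tabulate)
open import Data.Sum using (_⊎_; inj₁; inj₂)
open import Data.Sum.Properties using (≡-dec; inj₁-injective; inj₂-injective)
open import Data.Bool using (if_then_else_)
open import Data.Product using (_×_; _,_)
open import Data.Empty using (⊥-elim)
open import Function using (_∘_; id)
open import Induction.WellFounded using (WellFounded; Acc; acc)
open import Relation.Binary using (Rel; Decidable; DecidableEquality; IsPartialOrder)
open import Relation.Binary.PropositionalEquality
  using (_≡_; _≢_; _≗_; refl; sym; trans; cong; cong₂; module ≡-Reasoning)
open import Relation.Nullary using (¬_; Dec; does; yes; no)
open import Relation.Nullary.Decidable using (_×-dec_)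

when : {P : Set} → Dec P → ℤ → ℤ
when d u = if does d then u else 0ℤ

when-yes : {P : Set} (d : Dec P) {u : ℤ} → P → when d u ≡ u
when-yes (yes _) _ = refl
when-yes (no ¬p) p = ⊥-elim (¬p p)

when-no : {P : Set} (d : Dec P) {u : ℤ} → ¬ P → when d u ≡ 0ℤ
when-no (yes p) ¬p = ⊥-elim (¬p p)
when-no (no _)  _  = refl

when-vanishing : {P : Set} (d : Dec P) {u : ℤ} → u ≡ 0ℤ → when d u ≡ 0ℤ
when-vanishing (yes _) u≡0 = u≡0
when-vanishing (no _)  _   = refl

when-iff : {P R : Set} (d : Dec P) (e : Dec R) {u : ℤ} →
           (P → R) → (R → P) → when d u ≡ when e u
when-iff (yes _) (yes _) _ _ = refl
when-iff (yes p) (no ¬r) f _ = ⊥-elim (¬r (f p))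
when-iff (no ¬p) (yes r) _ g = ⊥-elim (¬p (g r))
when-iff (no _)  (no _)  _ _ = refl

when-when : {P R : Set} (d : Dec P) (e : Dec R) (u : ℤ) →
            when d (when e u) ≡ when (e ×-dec d) u
when-when (yes _) (yes _) u = refl
when-when (yes _) (no _)  u = refl
when-when (no _)  (yes _) u = refl
when-when (no _)  (no _)  u = refl

when-* : {P R : Set} (d : Dec P) (e : Dec R) (u v : ℤ) →
         when d u * when e v ≡ when (d ×-dec e) (u * v)
when-* (yes _) (yes _) u v = refl
when-* (yes _) (no _)  u v = *-zeroʳ u
when-* (no _)  _       u v = refl

when-difference : {P : Set} (d : Dec P) (u v : ℤ) → (P → u ≡ v) → when d u - when d v ≡ 0ℤ
when-difference (yes p) u v u≡v = trans (cong (λ t → u - t) (sym (u≡v p))) (+-inverseʳ u)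
when-difference (no _)  u v _   = refl

when-neg : {P : Set} (d : Dec P) (u : ℤ) → when d (- u) ≡ - when d u
when-neg (yes _) u = refl
when-neg (no _)  u = refl

-- The sum ∑ of Defs agrees with the library's summation of vectors,
-- through which we inherit its algebraic laws.
∑≡sum : ∀ n (f : Fin n → ℤ) → ∑ n f ≡ Sum.sum f
∑≡sum n f = trans (cong (foldr _+_ 0ℤ) (map-tabulate id f)) (foldr-tabulate n f)
  where
  foldr-tabulate : ∀ n (f : Fin n → ℤ) → foldr _+_ 0ℤ (tabulate f) ≡ Sum.sum f
  foldr-tabulate zero    f = refl
  foldr-tabulate (suc n) f = cong (f zero +_) (foldr-tabulate n (f ∘ suc))

∑-cong : ∀ {n} {f g : Fin n → ℤ} → f ≗ g → ∑ n f ≡ ∑ n g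
∑-cong {n} {f} {g} f≗g =
  trans (∑≡sum n f) (trans (Sum.sum-cong-≗ f≗g) (sym (∑≡sum n g)))

∑-zero : ∀ {n} {f : Fin n → ℤ} → (∀ i → f i ≡ 0ℤ) → ∑ n f ≡ 0ℤ
∑-zero {n} f≡0 =
  trans (∑-cong f≡0) (trans (∑≡sum n _) (Sum.sum-replicate-zero n))

∑-+ : ∀ n (f g : Fin n → ℤ) → ∑ n (λ i → f i + g i) ≡ ∑ n f + ∑ n g
∑-+ n f g = begin
  ∑ n (λ i → f i + g i)     ≡⟨ ∑≡sum n _ ⟩
  Sum.sum (λ i → f i + g i) ≡⟨ Sum.∑-distrib-+ f g ⟩
  Sum.sum f + Sum.sum g     ≡⟨ sym (cong₂ _+_ (∑≡sum n f) (∑≡sum n g)) ⟩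
  ∑ n f + ∑ n g             ∎
  where open ≡-Reasoning

∑-*ˡ : ∀ n c (f : Fin n → ℤ) → ∑ n (λ i → c * f i) ≡ c * ∑ n f
∑-*ˡ n c f = begin
  ∑ n (λ i → c * f i)     ≡⟨ ∑≡sum n _ ⟩
  Sum.sum (λ i → c * f i) ≡⟨ sym (Sum.*-distribˡ-sum c f) ⟩
  c * Sum.sum f           ≡⟨ sym (cong (c *_) (∑≡sum n f)) ⟩
  c * ∑ n f               ∎
  where open ≡-Reasoning

∑-neg : ∀ n (f : Fin n → ℤ) → ∑ n (λ i → - f i) ≡ - ∑ n f
∑-neg n f = begin
  ∑ n (λ i → - f i)     ≡⟨ ∑-cong (λ i → sym (-1*i≡-i (f i))) ⟩
  ∑ n (λ i → -1ℤ * f i) ≡⟨ ∑-*ˡ n -1ℤ f ⟩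
  -1ℤ * ∑ n f           ≡⟨ -1*i≡-i (∑ n f) ⟩
  - ∑ n f               ∎
  where open ≡-Reasoning

∑-swap : ∀ n m (f : Fin n → Fin m → ℤ) →
         ∑ n (λ a → ∑ m (f a)) ≡ ∑ m (λ b → ∑ n (λ a → f a b))
∑-swap n m f = begin
  ∑ n (λ a → ∑ m (f a))                 ≡⟨ ∑≡sum n _ ⟩
  Sum.sum (λ a → ∑ m (f a))             ≡⟨ Sum.sum-cong-≗ (λ a → ∑≡sum m (f a)) ⟩
  Sum.sum (λ a → Sum.sum (f a))         ≡⟨ Sum.∑-comm f ⟩
  Sum.sum (λ b → Sum.sum (λ a → f a b)) ≡⟨ sym (Sum.sum-cong-≗ (λ b → ∑≡sum n (λ a → f a b))) ⟩
  Sum.sum (λ b → ∑ n (λ a → f a b))     ≡⟨ sym (∑≡sum m _) ⟩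
  ∑ m (λ b → ∑ n (λ a → f a b))         ∎
  where open ≡-Reasoning

∑-point : ∀ n (f : Fin n → ℤ) (y : Fin n) → (∀ i → i ≢ y → f i ≡ 0ℤ) → ∑ n f ≡ f y
∑-point (suc n) f y vanish = begin
  ∑ (suc n) f                   ≡⟨ ∑≡sum (suc n) f ⟩
  Sum.sum f                     ≡⟨ Sum.sum-remove {i = y} f ⟩
  f y + Sum.sum (f ∘ punchIn y) ≡⟨ cong (f y +_) rest-vanishes ⟩
  f y + 0ℤ                      ≡⟨ +-identityʳ (f y) ⟩
  f y                           ∎
  where
  open ≡-Reasoning
  rest-vanishes : Sum.sum (f ∘ punchIn y) ≡ 0ℤ
  rest-vanishes = trans (sym (∑≡sum n _))
                        (∑-zero (λ j → vanish (punchIn y j) (punchInᵢ≢i y j)))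

when-∑ : {P : Set} (d : Dec P) (n : ℕ) (f : Fin n → ℤ) →
         when d (∑ n f) ≡ ∑ n (λ i → when d (f i))
when-∑ (yes _) n f = refl
when-∑ (no _)  n f = sym (∑-zero {n} (λ _ → refl))

module _ {n₀ n₁ : ℕ} where

  ∑⊎-cong : {f g : Fin n₀ ⊎ Fin n₁ → ℤ} → f ≗ g → ∑⊎ n₀ n₁ f ≡ ∑⊎ n₀ n₁ g
  ∑⊎-cong f≗g = cong₂ _+_ (∑-cong (f≗g ∘ inj₁)) (∑-cong (f≗g ∘ inj₂))

  ∑⊎-+ : (f g : Fin n₀ ⊎ Fin n₁ → ℤ) →
         ∑⊎ n₀ n₁ (λ z → f z + g z) ≡ ∑⊎ n₀ n₁ f + ∑⊎ n₀ n₁ g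
  ∑⊎-+ f g = trans (cong₂ _+_ (∑-+ n₀ (f ∘ inj₁) (g ∘ inj₁)) (∑-+ n₁ (f ∘ inj₂) (g ∘ inj₂)))
                   (interchange (∑ n₀ (f ∘ inj₁)) (∑ n₀ (g ∘ inj₁)) (∑ n₁ (f ∘ inj₂)) (∑ n₁ (g ∘ inj₂)))

  ∑⊎-point : (f : Fin n₀ ⊎ Fin n₁ → ℤ) (y : Fin n₀ ⊎ Fin n₁) → (∀ z → z ≢ y → f z ≡ 0ℤ) →
             ∑⊎ n₀ n₁ f ≡ f y
  ∑⊎-point f (inj₁ y) vanish =
    trans (cong₂ _+_ (∑-point n₀ (f ∘ inj₁) y (λ z z≢y → vanish (inj₁ z) (z≢y ∘ inj₁-injective)))
                     (∑-zero (λ z → vanish (inj₂ z) λ ())))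
          (+-identityʳ (f (inj₁ y)))
  ∑⊎-point f (inj₂ y) vanish =
    trans (cong₂ _+_ (∑-zero (λ z → vanish (inj₁ z) λ ()))
                     (∑-point n₁ (f ∘ inj₂) y (λ z z≢y → vanish (inj₂ z) (z≢y ∘ inj₂-injective))))
          (+-identityˡ (f (inj₂ y)))

split-difference : ∀ i j → i ≡ j + (i - j)
split-difference = solve-∀

-- By
-- well-founded induction on y, μ(x,z) is known for x ≤ z < y, and the
-- recursion Σ_{x ≤ z ≤ y} μ(x,z) = 0 then determines μ(x,y).
module MobiusUniqueness
  {A : Set} (sumA : (A → ℤ) → ℤ)
  (sumA-cong : ∀ {f g} → f ≗ g → sumA f ≡ sumA g)
  (sumA-+ : ∀ f g → sumA (λ z → f z + g z) ≡ sumA f + sumA g)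
  (sumA-point : ∀ f y → (∀ z → z ≢ y → f z ≡ 0ℤ) → sumA f ≡ f y)
  (_≟_ : DecidableEquality A)
  (_≤_ : Rel A 0ℓ) (_≤?_ : Decidable _≤_) (≤-refl : ∀ {a} → a ≤ a)
  (<-wellFounded : WellFounded (λ a b → a ≤ b × a ≢ b)) where

  mobius-unique : ∀ {f g} → IsMobius sumA _≤_ _≤?_ f → IsMobius sumA _≤_ _≤?_ g →
                  ∀ x y → f x y ≡ g x y
  mobius-unique {f} {g} (f-diag , f-off , f-rec) (g-diag , g-off , g-rec) x y =
    below-y (<-wellFounded y)
    where
    below-y : ∀ {y} → Acc (λ a b → a ≤ b × a ≢ b) y → f x y ≡ g x y
    below-y {y} (acc smaller) with x ≤? y | x ≟ y
    ... | no x≰y  | _        = trans (f-off x y x≰y) (sym (g-off x y x≰y))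
    ... | yes _   | yes refl = trans (f-diag x) (sym (g-diag x))
    ... | yes x≤y | no x≢y   = i-j≡0⇒i≡j (f x y) (g x y) difference-vanishes
      where
      interval : ∀ z → Dec (x ≤ z × z ≤ y)
      interval z = (x ≤? z) ×-dec (z ≤? y)

      difference : A → ℤ
      difference z = when (interval z) (f x z) - when (interval z) (g x z)

      supported-at-y : ∀ z → z ≢ y → difference z ≡ 0ℤ
      supported-at-y z z≢y = when-difference (interval z) (f x z) (g x z)
        (λ { (_ , z≤y) → below-y (smaller (z≤y , z≢y)) })

      sum-difference : sumA difference ≡ 0ℤ
      sum-difference = begin
        sumA difference                                             ≡⟨ sym (+-identityˡ _) ⟩
        0ℤ + sumA difference                                        ≡⟨ cong (_+ sumA difference) (sym (g-rec x y x≤y x≢y)) ⟩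
        sumA (λ z → when (interval z) (g x z)) + sumA difference    ≡⟨ sym (sumA-+ _ _) ⟩
        sumA (λ z → when (interval z) (g x z) + difference z)       ≡⟨ sumA-cong (λ z → sym (split-difference (when (interval z) (f x z)) (when (interval z) (g x z)))) ⟩
        sumA (λ z → when (interval z) (f x z))                      ≡⟨ f-rec x y x≤y x≢y ⟩
        0ℤ                                                          ∎
        where open ≡-Reasoning

      difference-vanishes : f x y - g x y ≡ 0ℤ
      difference-vanishes = begin
        f x y - g x y     ≡⟨ sym (cong₂ _-_ (when-yes (interval y) (x≤y , ≤-refl))
                                            (when-yes (interval y) (x≤y , ≤-refl))) ⟩
        difference y      ≡⟨ sym (sumA-point difference y supported-at-y) ⟩
        sumA difference   ≡⟨ sum-difference ⟩
        0ℤ                ∎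
        where open ≡-Reasoning

module IntervalSums (R : FinPoset) (μ : Fin (n R) → Fin (n R) → ℤ)
                    (isMobius : IsMobiusOf R μ) where
  private
    module ≤R = IsPartialOrder (isPartialOrder R)
    _≤R?_ : Decidable (_≤_ R)
    _≤R?_ = _≤?_ R

  interval-sum : Fin (n R) → Fin (n R) → ℤ
  interval-sum p y = ∑ (n R) (λ z → when ((p ≤R? z) ×-dec (z ≤R? y)) (μ p z))

  interval-sum-diag : ∀ y → interval-sum y y ≡ 1ℤ
  interval-sum-diag y =
    trans (∑-point (n R) _ y only-y)
          (trans (when-yes ((y ≤R? y) ×-dec (y ≤R? y)) (≤R.refl , ≤R.refl))
                 (let (diag , _ , _) = isMobius in diag y))
    where
    only-y : ∀ z → z ≢ y → when ((y ≤R? z) ×-dec (z ≤R? y)) (μ y z) ≡ 0ℤ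
    only-y z z≢y = when-no ((y ≤R? z) ×-dec (z ≤R? y))
                           (λ { (y≤z , z≤y) → z≢y (≤R.antisym z≤y y≤z) })

  interval-sum-off : ∀ p y → p ≢ y → interval-sum p y ≡ 0ℤ
  interval-sum-off p y p≢y with p ≤R? y
  ... | yes p≤y = let (_ , _ , recursion) = isMobius in recursion p y p≤y p≢y
  ... | no p≰y  = ∑-zero (λ z → when-no ((p ≤R? z) ×-dec (z ≤R? y))
                                        (λ { (p≤z , z≤y) → p≰y (≤R.trans p≤z z≤y) }))

module ConnectedSumMobius (Q P₀ P₁ : FinPoset)
  (i₀ : Fin (n Q) → Fin (n P₀)) (i₁ : Fin (n Q) → Fin (n P₁))
  (μ₀ : Fin (n P₀) → Fin (n P₀) → ℤ) (μ₀-mobius : IsMobiusOf P₀ μ₀)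
  (μ₁ : Fin (n P₁) → Fin (n P₁) → ℤ) (μ₁-mobius : IsMobiusOf P₁ μ₁) where

  open ConnectedSum Q P₀ P₁ i₀ i₁
  open IntervalSums P₁ μ₁ μ₁-mobius
  private
    module ≤₀ = IsPartialOrder (isPartialOrder P₀)
    module ≤₁ = IsPartialOrder (isPartialOrder P₁)
    n₀ n₁ : ℕ
    n₀ = n P₀
    n₁ = n P₁
    _≤₀?_ : Decidable (_≤_ P₀)
    _≤₀?_ = _≤?_ P₀
    _≤₁?_ : Decidable (_≤_ P₁)
    _≤₁?_ = _≤?_ P₁

  P : Set
  P = Fin n₀ ⊎ Fin n₁

  ⪯-refl : ∀ {a} → a ⪯ a
  ⪯-refl {inj₁ _} = in₀ ≤₀.refl
  ⪯-refl {inj₂ _} = in₁ ≤₁.refl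

  ⪯-trans : ∀ {a b c} → a ⪯ b → b ⪯ c → a ⪯ c
  ⪯-trans (in₀ a≤b)              (in₀ b≤c)              = in₀ (≤₀.trans a≤b b≤c)
  ⪯-trans (in₀ a≤b)              (cross (q , b≤q , q≤c)) = cross (q , ≤₀.trans a≤b b≤q , q≤c)
  ⪯-trans (in₁ a≤b)              (in₁ b≤c)              = in₁ (≤₁.trans a≤b b≤c)
  ⪯-trans (cross (q , a≤q , q≤b)) (in₁ b≤c)              = cross (q , a≤q , ≤₁.trans q≤b b≤c)

  _≟P_ : DecidableEquality P
  _≟P_ = ≡-dec _≟ᶠ_ _≟ᶠ_

  _≺_ : Rel P 0ℓ
  a ≺ b = a ⪯ b × a ≢ b

  -- Everything strictly below an element of P₀ lies in P₀, and everything
  -- below an element of P₁ lies in P₀ or strictly below it in P₁; so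
  -- accessibility lifts from the well-founded strict orders of P₀ and P₁.
  ≺-wellFounded : WellFounded _≺_
  ≺-wellFounded (inj₁ x) = lower (po-wellFounded (isPartialOrder P₀) x)
    where
    lower : ∀ {x} → Acc (_<_ P₀) x → Acc _≺_ (inj₁ x)
    lower (acc smaller) = acc λ { (in₀ z≤x , z≢x) → lower (smaller (z≤x , z≢x ∘ cong inj₁)) }
  ≺-wellFounded (inj₂ y) = upper (po-wellFounded (isPartialOrder P₁) y)
    where
    upper : ∀ {y} → Acc (_<_ P₁) y → Acc _≺_ (inj₂ y)
    upper (acc smaller) = acc λ
      { {inj₁ x} _      → ≺-wellFounded (inj₁ x)
      ; (in₁ z≤y , z≢y) → upper (smaller (z≤y , z≢y ∘ cong inj₂)) }

  F : P → P → ℤ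
  F = formula μ₀ μ₁

  term : Fin n₀ → Fin n₁ → Fin n₀ → Fin n₁ → ℤ
  term x y p₀ p₁ =
    when ((x ≤₀? p₀) ×-dec (inj₁ p₀ ⪯? inj₂ p₁) ×-dec (p₁ ≤₁? y)) (μ₀ x p₀ * μ₁ p₁ y)

  -- If x ⋠ y every summand has an empty chain x ≤ p₀ ⪯ p₁ ≤ y.
  cross-vanishes : ∀ x y → ¬ Cross x y → F (inj₁ x) (inj₂ y) ≡ 0ℤ
  cross-vanishes x y x⋠y = cong -_ (∑-zero λ p₀ → ∑-zero λ p₁ →
    when-no ((x ≤₀? p₀) ×-dec (inj₁ p₀ ⪯? inj₂ p₁) ×-dec (p₁ ≤₁? y))
            (λ { (x≤p₀ , p₀⪯p₁ , p₁≤y) →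
                 x⋠y (unCross (⪯-trans (⪯-trans (in₀ x≤p₀) p₀⪯p₁) (in₁ p₁≤y))) }))
    where
    unCross : ∀ {x y} → inj₁ x ⪯ inj₂ y → Cross x y
    unCross (cross c) = c

  F-diag : ∀ a → F a a ≡ 1ℤ
  F-diag (inj₁ x) = let (diag , _ , _) = μ₀-mobius in diag x
  F-diag (inj₂ y) = let (diag , _ , _) = μ₁-mobius in diag y

  F-off : ∀ a b → ¬ (a ⪯ b) → F a b ≡ 0ℤ
  F-off (inj₁ x) (inj₁ y) x⋠y = let (_ , off , _) = μ₀-mobius in off x y (x⋠y ∘ in₀)
  F-off (inj₂ x) (inj₂ y) x⋠y = let (_ , off , _) = μ₁-mobius in off x y (x⋠y ∘ in₁)
  F-off (inj₁ x) (inj₂ y) x⋠y = cross-vanishes x y (x⋠y ∘ cross)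
  F-off (inj₂ x) (inj₁ y) _   = refl

  -- The P₀-part of Σ_{x ⪯ z ⪯ y} F(x,z)
  -- is Σ_{p₀} lower p₀; expanding F(x,z) on P₁ and exchanging sums shows the
  -- P₁-part is −Σ_{p₀} Σ_{p₁} weight p₀ p₁ · Σ_{p₁ ≤ z ≤ y} μ₁(p₁,z),
  -- which by the interval sums of μ₁ collapses to −Σ_{p₀} lower p₀.
  module CrossRecursion (x : Fin n₀) (y : Fin n₁) where

    lower : Fin n₀ → ℤ
    lower p₀ = when ((inj₁ x ⪯? inj₁ p₀) ×-dec (inj₁ p₀ ⪯? inj₂ y)) (μ₀ x p₀)

    upper : Fin n₁ → ℤ
    upper z = when ((inj₁ x ⪯? inj₂ z) ×-dec (inj₂ z ⪯? inj₂ y)) (F (inj₁ x) (inj₂ z))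

    weight : Fin n₀ → Fin n₁ → ℤ
    weight p₀ p₁ = when ((x ≤₀? p₀) ×-dec cross? p₀ p₁) (μ₀ x p₀)

    segment : Fin n₁ → Fin n₁ → ℤ
    segment p₁ z = when ((p₁ ≤₁? z) ×-dec (z ≤₁? y)) (μ₁ p₁ z)

    -- For z ∈ P₁ the condition x ⪯ z may be dropped: F(x,z) = 0 without it.
    upper-restricted : ∀ z → upper z ≡ when (z ≤₁? y) (F (inj₁ x) (inj₂ z))
    upper-restricted z = by-cases (cross? x z)
      where
      by-cases : Dec (Cross x z) → upper z ≡ when (z ≤₁? y) (F (inj₁ x) (inj₂ z))
      by-cases (yes x⪯z) = when-iff ((inj₁ x ⪯? inj₂ z) ×-dec (inj₂ z ⪯? inj₂ y)) (z ≤₁? y)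
                                    (λ { (_ , in₁ z≤y) → z≤y }) (λ z≤y → cross x⪯z , in₁ z≤y)
      by-cases (no x⋠z)  = trans (when-no ((inj₁ x ⪯? inj₂ z) ×-dec (inj₂ z ⪯? inj₂ y))
                                          (λ { (cross x⪯z , _) → x⋠z x⪯z }))
                                 (sym (when-vanishing (z ≤₁? y) (cross-vanishes x z x⋠z)))

    term-factors : ∀ z p₀ p₁ → when (z ≤₁? y) (term x z p₀ p₁) ≡ weight p₀ p₁ * segment p₁ z
    term-factors z p₀ p₁ = begin
      when (z ≤₁? y) (term x z p₀ p₁)
        ≡⟨ when-when (z ≤₁? y) chain (μ₀ x p₀ * μ₁ p₁ z) ⟩
      when (chain ×-dec (z ≤₁? y)) (μ₀ x p₀ * μ₁ p₁ z)
        ≡⟨ when-iff (chain ×-dec (z ≤₁? y)) (((x ≤₀? p₀) ×-dec cross? p₀ p₁) ×-dec ((p₁ ≤₁? z) ×-dec (z ≤₁? y)))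
                    (λ { ((x≤p₀ , cross p₀⪯p₁ , p₁≤z) , z≤y) → (x≤p₀ , p₀⪯p₁) , (p₁≤z , z≤y) })
                    (λ { ((x≤p₀ , p₀⪯p₁) , (p₁≤z , z≤y)) → (x≤p₀ , cross p₀⪯p₁ , p₁≤z) , z≤y }) ⟩
      when (((x ≤₀? p₀) ×-dec cross? p₀ p₁) ×-dec ((p₁ ≤₁? z) ×-dec (z ≤₁? y))) (μ₀ x p₀ * μ₁ p₁ z)
        ≡⟨ sym (when-* ((x ≤₀? p₀) ×-dec cross? p₀ p₁) ((p₁ ≤₁? z) ×-dec (z ≤₁? y)) _ _) ⟩
      weight p₀ p₁ * segment p₁ z ∎
      where
      open ≡-Reasoning
      chain : Dec (_≤_ P₀ x p₀ × inj₁ p₀ ⪯ inj₂ p₁ × _≤_ P₁ p₁ z)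
      chain = (x ≤₀? p₀) ×-dec (inj₁ p₀ ⪯? inj₂ p₁) ×-dec (p₁ ≤₁? z)

    upper-expanded : ∀ z → upper z ≡ - ∑ n₀ (λ p₀ → ∑ n₁ (λ p₁ → weight p₀ p₁ * segment p₁ z))
    upper-expanded z = begin
      upper z
        ≡⟨ upper-restricted z ⟩
      when (z ≤₁? y) (- ∑ n₀ (λ p₀ → ∑ n₁ (term x z p₀)))
        ≡⟨ when-neg (z ≤₁? y) _ ⟩
      - when (z ≤₁? y) (∑ n₀ (λ p₀ → ∑ n₁ (term x z p₀)))
        ≡⟨ cong -_ (when-∑ (z ≤₁? y) n₀ _) ⟩
      - ∑ n₀ (λ p₀ → when (z ≤₁? y) (∑ n₁ (term x z p₀)))
        ≡⟨ cong -_ (∑-cong λ p₀ → trans (when-∑ (z ≤₁? y) n₁ _) (∑-cong (term-factors z p₀))) ⟩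
      - ∑ n₀ (λ p₀ → ∑ n₁ (λ p₁ → weight p₀ p₁ * segment p₁ z)) ∎
      where open ≡-Reasoning

    -- Only p₁ = y survives, where the weight becomes the summand of lower.
    collapse : ∀ p₀ → ∑ n₁ (λ p₁ → weight p₀ p₁ * interval-sum p₁ y) ≡ lower p₀
    collapse p₀ = begin
      ∑ n₁ (λ p₁ → weight p₀ p₁ * interval-sum p₁ y)
        ≡⟨ ∑-point n₁ _ y (λ p₁ p₁≢y →
             trans (cong (weight p₀ p₁ *_) (interval-sum-off p₁ y p₁≢y)) (*-zeroʳ (weight p₀ p₁))) ⟩
      weight p₀ y * interval-sum y y
        ≡⟨ trans (cong (weight p₀ y *_) (interval-sum-diag y)) (*-identityʳ _) ⟩
      weight p₀ y
        ≡⟨ when-iff ((x ≤₀? p₀) ×-dec cross? p₀ y) ((inj₁ x ⪯? inj₁ p₀) ×-dec (inj₁ p₀ ⪯? inj₂ y))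
                    (λ { (x≤p₀ , p₀⪯y) → in₀ x≤p₀ , cross p₀⪯y })
                    (λ { (in₀ x≤p₀ , cross p₀⪯y) → x≤p₀ , p₀⪯y }) ⟩
      lower p₀ ∎
      where open ≡-Reasoning

    upper-sum : ∑ n₁ upper ≡ - ∑ n₀ lower
    upper-sum = begin
      ∑ n₁ upper
        ≡⟨ ∑-cong upper-expanded ⟩
      ∑ n₁ (λ z → - ∑ n₀ (λ p₀ → ∑ n₁ (λ p₁ → weight p₀ p₁ * segment p₁ z)))
        ≡⟨ ∑-neg n₁ _ ⟩
      - ∑ n₁ (λ z → ∑ n₀ (λ p₀ → ∑ n₁ (λ p₁ → weight p₀ p₁ * segment p₁ z)))
        ≡⟨ cong -_ (∑-swap n₁ n₀ _) ⟩
      - ∑ n₀ (λ p₀ → ∑ n₁ (λ z → ∑ n₁ (λ p₁ → weight p₀ p₁ * segment p₁ z)))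
        ≡⟨ cong -_ (∑-cong λ p₀ → ∑-swap n₁ n₁ (λ z p₁ → weight p₀ p₁ * segment p₁ z)) ⟩
      - ∑ n₀ (λ p₀ → ∑ n₁ (λ p₁ → ∑ n₁ (λ z → weight p₀ p₁ * segment p₁ z)))
        ≡⟨ cong -_ (∑-cong λ p₀ → ∑-cong λ p₁ → ∑-*ˡ n₁ (weight p₀ p₁) (segment p₁)) ⟩
      - ∑ n₀ (λ p₀ → ∑ n₁ (λ p₁ → weight p₀ p₁ * interval-sum p₁ y))
        ≡⟨ cong -_ (∑-cong collapse) ⟩
      - ∑ n₀ lower ∎
      where open ≡-Reasoning

    cross-recursion : ∑ n₀ lower + ∑ n₁ upper ≡ 0ℤ
    cross-recursion = trans (cong (∑ n₀ lower +_) upper-sum) (+-inverseʳ (∑ n₀ lower))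

  F-rec : ∀ a b → a ⪯ b → a ≢ b →
          ∑⊎ n₀ n₁ (λ z → when ((a ⪯? z) ×-dec (z ⪯? b)) (F a z)) ≡ 0ℤ
  F-rec (inj₁ x) (inj₁ y) (in₀ x≤y) x≢y =
    trans (cong₂ _+_
            (trans (∑-cong λ z → when-iff ((inj₁ x ⪯? inj₁ z) ×-dec (inj₁ z ⪯? inj₁ y))
                                          ((x ≤₀? z) ×-dec (z ≤₀? y))
                                          (λ { (in₀ x≤z , in₀ z≤y) → x≤z , z≤y })
                                          (λ { (x≤z , z≤y) → in₀ x≤z , in₀ z≤y }))
                   (let (_ , _ , recursion) = μ₀-mobius in recursion x y x≤y (x≢y ∘ cong inj₁)))
            (∑-zero λ z → when-no ((inj₁ x ⪯? inj₂ z) ×-dec (inj₂ z ⪯? inj₁ y)) λ { (_ , ()) }))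
          (+-identityʳ 0ℤ)
  F-rec (inj₂ x) (inj₂ y) (in₁ x≤y) x≢y =
    trans (cong₂ _+_
            (∑-zero λ z → when-no ((inj₂ x ⪯? inj₁ z) ×-dec (inj₁ z ⪯? inj₂ y)) {F (inj₂ x) (inj₁ z)}
                                  λ { (() , _) })
            (trans (∑-cong λ z → when-iff ((inj₂ x ⪯? inj₂ z) ×-dec (inj₂ z ⪯? inj₂ y))
                                          ((x ≤₁? z) ×-dec (z ≤₁? y))
                                          (λ { (in₁ x≤z , in₁ z≤y) → x≤z , z≤y })
                                          (λ { (x≤z , z≤y) → in₁ x≤z , in₁ z≤y }))
                   (let (_ , _ , recursion) = μ₁-mobius in recursion x y x≤y (x≢y ∘ cong inj₂))))
          (+-identityʳ 0ℤ)
  F-rec (inj₁ x) (inj₂ y) (cross _) _ = CrossRecursion.cross-recursion x y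

  formula-isMobius : IsMobiusP F
  formula-isMobius = F-diag , F-off , F-rec

proposition1p2 : (Q P₀ P₁ : FinPoset)
    → (i₀ : Fin (n Q) → Fin (n P₀)) → (i₁ : Fin (n Q) → Fin (n P₁))
    → IsOrderEmbedding Q P₀ i₀ → IsOrderEmbedding Q P₁ i₁
    → (μ₀ : Fin (n P₀) → Fin (n P₀) → ℤ) → IsMobiusOf P₀ μ₀
    → (μ₁ : Fin (n P₁) → Fin (n P₁) → ℤ) → IsMobiusOf P₁ μ₁
    → (μ : Fin (n P₀) ⊎ Fin (n P₁) → Fin (n P₀) ⊎ Fin (n P₁) → ℤ)
    → ConnectedSum.IsMobiusP Q P₀ P₁ i₀ i₁ μ
    → ∀ x y → μ x y ≡ ConnectedSum.formula Q P₀ P₁ i₀ i₁ μ₀ μ₁ x y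
proposition1p2 Q P₀ P₁ i₀ i₁ _ _ μ₀ μ₀-mobius μ₁ μ₁-mobius μ μ-mobius =
  mobius-unique μ-mobius formula-isMobius
  where
  open ConnectedSum Q P₀ P₁ i₀ i₁ using (_⪯_; _⪯?_)
  open ConnectedSumMobius Q P₀ P₁ i₀ i₁ μ₀ μ₀-mobius μ₁ μ₁-mobius
  open MobiusUniqueness (∑⊎ (n P₀) (n P₁)) ∑⊎-cong ∑⊎-+ ∑⊎-point _≟P_ _⪯_ _⪯?_ ⪯-refl ≺-wellFounded
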